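{- For every $n\in\mathbb{N}$, the path $P_n$ on $n$ vertices satisfies $\mathrm{avg}_1(P_n) \le \frac{2n+1}{3}$.
   Context: Let $G=(V,E)$ be a finite connected graph with a fixed root $v_0$. A $1$-Lipschitz mapping of $G$ is a map $f:V\to\mathbb{Z}$ with $f(v_0)=0$ and $|f(u)-f(v)|\le 1$ for every edge $uv$; the set of these is $\mathcal{L}_1(G)$. The range of $f$ is $\mathrm{rng}(f)=|\{f(v):v\in V\}|$, and $\mathrm{avg}_1(G)=\frac{\sum_{f\in\mathcal{L}_1(G)}\mathrm{rng}(f)}{|\mathcal{L}_1(G)|}$ (independent of the choice of root). -}

module Defs where

open import Data.Nat using (ℕ; suc; _+_; _≤_)
open import Data.Integer as ℤ using (ℤ; +_; _-_; ∣_∣)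
open import Data.Fin using (Fin; toℕ; zero)
open import Data.Vec using (Vec; lookup; toList)
open import Data.List using (List; length; deduplicate)
open import Data.Sum using (_⊎_)
open import Data.Product using (_×_)
open import Data.Integer.Properties using () renaming (_≟_ to _≟ℤ_)
open import Relation.Binary.PropositionalEquality using (_≡_)

PathAdj : {n : ℕ} → Fin n → Fin n → Set
PathAdj u v = (suc (toℕ u) ≡ toℕ v) ⊎ (suc (toℕ v) ≡ toℕ u)

Map : ℕ → Set
Map n = Vec ℤ n

-- 1-Lipschitz mappings of P_{suc m}, rooted at the endpoint v0 = vertex 0.
Lipschitz1 : {m : ℕ} → Map (suc m) → Set
Lipschitz1 {m} f =
  (lookup f zero ≡ + 0) × ((u v : Fin (suc m)) → PathAdj u v → ∣ lookup f u - lookup f v ∣ ≤ 1)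

rng : {n : ℕ} → Map n → ℕ
rng f = length (deduplicate _≟ℤ_ (toList f))

-- A 1-Lipschitz map of the path rooted at the endpoint v₀ is a walk 0 = f(v₀), f(v₁), …, f(vₘ)
-- whose steps are −1, 0 or +1, so there are exactly 3^m of them. The range of a walk exceeds the
-- number of its non-zero steps by at most one, and over all 3^m walks exactly two thirds of the
-- m·3^m steps are non-zero. Hence Σ rng ≤ 3^m + 2m·3^(m-1) = (2n+1)/3 · 3^m, where n = m + 1.

module Submission where

open import Defs
open import Data.Nat using (ℕ; suc; _+_; _*_; _≤_)
open import Data.List using (List; length; map)
open import Data.Nat.ListAction using (sum)
open import Data.List.Relation.Unary.All using (All)
open import Data.List.Relation.Unary.Unique.Propositional using (Unique)
open import Data.List.Membership.Propositional using (_∈_)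

open import Data.Bool using (if_then_else_)
open import Data.Fin using (Fin; zero; suc)
open import Data.Integer using (ℤ; +0; +[1+_]; -[1+_]; 0ℤ; 1ℤ; _-_; ∣_∣) renaming (_+_ to _+ℤ_)
open import Data.Integer.Properties using (∣i-j∣≡∣j-i∣; +-identityʳ; +-inverseʳ) renaming (_≟_ to _≟ℤ_)
import Data.Integer.Tactic.RingSolver as ℤ-Solver
open import Data.List using ([]; _∷_; _++_; deduplicate)
open import Data.List.Membership.Propositional.Properties using (∈-map⁺; ∈-map⁻; ∈-++⁺ˡ; ∈-++⁺ʳ; ∈-++⁻)
open import Data.List.Membership.Propositional.Properties.WithK using (unique∧set⇒bag)
open import Data.List.Properties using (length-map; length-++; map-++; map-∘; filter-reject; filter-idem; length-filter)
open import Data.List.Relation.Binary.BagAndSetEquality using (∼bag⇒↭)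
open import Data.List.Relation.Binary.Disjoint.Propositional using (Disjoint)
open import Data.List.Relation.Binary.Permutation.Propositional using (_↭_)
open import Data.List.Relation.Binary.Permutation.Propositional.Properties using (↭-length) renaming (map⁺ to ↭-map⁺)
import Data.List.Relation.Unary.All as All
open import Data.List.Relation.Unary.Any using (here)
import Data.List.Relation.Unary.Unique.Propositional.Properties as Unique
open import Data.Nat using (z≤n; s≤s; pred; _^_)
open import Data.Nat.ListAction.Properties using (sum-++; sum-↭)
open import Data.Nat.Properties using (≤-refl; ≤-reflexive; ≤-trans; +-mono-≤; *-monoʳ-≤; module ≤-Reasoning)
import Data.Nat.Tactic.RingSolver as ℕ-Solver
open import Data.Product using (_,_)
open import Data.Sum using (_⊎_; inj₁; inj₂)
import Data.Sum as Sum
open import Data.Vec using (Vec; []; _∷_; toList; lookup)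
open import Function using (_∘_)
open import Function.Bundles using (mk⇔)
open import Relation.Binary.Definitions using (DecidableEquality)
open import Relation.Binary.PropositionalEquality
open import Relation.Nullary using (Dec; yes; no; does; ¬?)
open import Relation.Nullary.Decidable using (dec-true; dec-false)

private
  variable
    k : ℕ
    a b : ℤ

i-[i-1]≡1 : ∀ a → a - (a - 1ℤ) ≡ 1ℤ
i-[i-1]≡1 = ℤ-Solver.solve-∀

i-[i+1]≡-1 : ∀ a → a - (a +ℤ 1ℤ) ≡ -[1+ 0 ]
i-[i+1]≡-1 = ℤ-Solver.solve-∀

∣i-j∣≤1⇒j∈i±1 : ∀ a b → ∣ a - b ∣ ≤ 1 → b ≡ a - 1ℤ ⊎ b ≡ a ⊎ b ≡ a +ℤ 1ℤ
∣i-j∣≤1⇒j∈i±1 a b = neighbour (a - b) (b≡a-[a-b] a b)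
  where
  b≡a-[a-b] : ∀ a b → b ≡ a - (a - b)
  b≡a-[a-b] = ℤ-Solver.solve-∀
  i--1≡i+1 : ∀ a → a - -[1+ 0 ] ≡ a +ℤ 1ℤ
  i--1≡i+1 = ℤ-Solver.solve-∀
  neighbour : ∀ d → b ≡ a - d → ∣ d ∣ ≤ 1 → b ≡ a - 1ℤ ⊎ b ≡ a ⊎ b ≡ a +ℤ 1ℤ
  neighbour +0         b≡a-d _ = inj₂ (inj₁ (trans b≡a-d (+-identityʳ a)))
  neighbour +[1+ 0 ]   b≡a-d _ = inj₁ b≡a-d
  neighbour -[1+ 0 ]   b≡a-d _ = inj₂ (inj₂ (trans b≡a-d (i--1≡i+1 a)))
  neighbour +[1+ suc _ ] _ (s≤s ())
  neighbour -[1+ suc _ ] _ (s≤s ())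

∣i-[i-1]∣≤1 : ∀ a → ∣ a - (a - 1ℤ) ∣ ≤ 1
∣i-[i-1]∣≤1 a rewrite i-[i-1]≡1 a = ≤-refl

∣i-i∣≤1 : ∀ a → ∣ a - a ∣ ≤ 1
∣i-i∣≤1 a rewrite +-inverseʳ a = z≤n

∣i-[i+1]∣≤1 : ∀ a → ∣ a - (a +ℤ 1ℤ) ∣ ≤ 1
∣i-[i+1]∣≤1 a rewrite i-[i+1]≡-1 a = ≤-refl

i-1≢i : ∀ a → a - 1ℤ ≢ a
i-1≢i a eq with trans (sym (i-[i-1]≡1 a)) (trans (cong (a -_) eq) (+-inverseʳ a))
... | ()

i≢i+1 : ∀ a → a ≢ a +ℤ 1ℤ
i≢i+1 a eq with trans (sym (+-inverseʳ a)) (trans (cong (a -_) eq) (i-[i+1]≡-1 a))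
... | ()

i-1≢i+1 : ∀ a → a - 1ℤ ≢ a +ℤ 1ℤ
i-1≢i+1 a eq with trans (sym (i-[i-1]≡1 a)) (trans (cong (a -_) eq) (i-[i+1]≡-1 a))
... | ()

data Walk (a : ℤ) : Vec ℤ k → Set where
  []  : Walk a []
  _∷_ : ∀ {b} {w : Vec ℤ k} → ∣ a - b ∣ ≤ 1 → Walk b w → Walk a (b ∷ w)

IsLipschitz : Map (suc k) → Set
IsLipschitz {k} f = (u v : Fin (suc k)) → PathAdj u v → ∣ lookup f u - lookup f v ∣ ≤ 1

PathAdj-pred : {u v : Fin k} → PathAdj {suc k} (suc u) (suc v) → PathAdj u v
PathAdj-pred = Sum.map (cong pred) (cong pred)

lipschitz⇒walk : (w : Vec ℤ k) → IsLipschitz (a ∷ w) → Walk a w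
lipschitz⇒walk []      _   = []
lipschitz⇒walk (b ∷ w) lip =
  lip zero (suc zero) (inj₁ refl) ∷ lipschitz⇒walk w (λ u v → lip (suc u) (suc v) ∘ Sum.map (cong suc) (cong suc))

walk⇒lipschitz : {w : Vec ℤ k} → Walk a w → IsLipschitz (a ∷ w)
walk⇒lipschitz (step ∷ _) zero (suc zero) _ = step
walk⇒lipschitz {a = a} {w = b ∷ _} (step ∷ _) (suc zero) zero _ = subst (_≤ 1) (∣i-j∣≡∣j-i∣ a b) step
walk⇒lipschitz (_ ∷ walk) (suc u) (suc v) adj = walk⇒lipschitz walk u v (PathAdj-pred adj)
walk⇒lipschitz _ zero zero (inj₁ ())
walk⇒lipschitz _ zero zero (inj₂ ())
walk⇒lipschitz (_ ∷ _) zero (suc (suc _)) (inj₁ ())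
walk⇒lipschitz (_ ∷ _) zero (suc (suc _)) (inj₂ ())
walk⇒lipschitz (_ ∷ _) (suc (suc _)) zero (inj₁ ())
walk⇒lipschitz (_ ∷ _) (suc (suc _)) zero (inj₂ ())

walksFrom : ℤ → (k : ℕ) → List (Vec ℤ (suc k))
continuations : ℤ → (k : ℕ) → List (Vec ℤ k)
walksFrom a k = map (a ∷_) (continuations a k)
continuations a 0       = [] ∷ []
continuations a (suc k) = walksFrom (a - 1ℤ) k ++ walksFrom a k ++ walksFrom (a +ℤ 1ℤ) k

∈-continuations⁺ : {w : Vec ℤ k} → Walk a w → w ∈ continuations a k
∈-continuations⁺ [] = here refl
∈-continuations⁺ {a = a} {w = b ∷ _} (step ∷ walk) with ∣i-j∣≤1⇒j∈i±1 a b step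
... | inj₁ refl        = ∈-++⁺ˡ (∈-map⁺ _ (∈-continuations⁺ walk))
... | inj₂ (inj₁ refl) = ∈-++⁺ʳ (walksFrom (a - 1ℤ) _) (∈-++⁺ˡ (∈-map⁺ _ (∈-continuations⁺ walk)))
... | inj₂ (inj₂ refl) = ∈-++⁺ʳ (walksFrom (a - 1ℤ) _) (∈-++⁺ʳ (walksFrom a _) (∈-map⁺ _ (∈-continuations⁺ walk)))

∈-walksFrom⁻ : ∀ {c} {v : Vec ℤ (suc k)} → ∣ a - c ∣ ≤ 1 → v ∈ walksFrom c k → Walk a v
∈-continuations⁻ : {w : Vec ℤ k} → w ∈ continuations a k → Walk a w
∈-walksFrom⁻ step v∈ with ∈-map⁻ _ v∈
... | _ , w∈ , refl = step ∷ ∈-continuations⁻ w∈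
∈-continuations⁻ {k = 0} {w = []} _ = []
∈-continuations⁻ {k = suc k} {a = a} w∈ with ∈-++⁻ (walksFrom (a - 1ℤ) k) w∈
... | inj₁ w∈₋ = ∈-walksFrom⁻ (∣i-[i-1]∣≤1 a) w∈₋
... | inj₂ w∈′ with ∈-++⁻ (walksFrom a k) w∈′
...   | inj₁ w∈₀ = ∈-walksFrom⁻ (∣i-i∣≤1 a) w∈₀
...   | inj₂ w∈₊ = ∈-walksFrom⁻ (∣i-[i+1]∣≤1 a) w∈₊

head-∈-walksFrom : ∀ {b} {w : Vec ℤ k} → b ∷ w ∈ walksFrom a k → b ≡ a
head-∈-walksFrom w∈ with ∈-map⁻ _ w∈
... | _ , _ , refl = refl

walksFrom-disjoint : a ≢ b → Disjoint (walksFrom a k) (walksFrom b k)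
walksFrom-disjoint a≢b {_ ∷ _} (v∈a , v∈b) =
  a≢b (trans (sym (head-∈-walksFrom v∈a)) (head-∈-walksFrom v∈b))

Disjoint-++⁺ʳ : {A : Set} {xs ys zs : List A} → Disjoint xs ys → Disjoint xs zs → Disjoint xs (ys ++ zs)
Disjoint-++⁺ʳ {ys = ys} xs#ys xs#zs (x∈xs , x∈ys++zs) with ∈-++⁻ ys x∈ys++zs
... | inj₁ x∈ys = xs#ys (x∈xs , x∈ys)
... | inj₂ x∈zs = xs#zs (x∈xs , x∈zs)

walksFrom-unique : ∀ a k → Unique (walksFrom a k)
continuations-unique : ∀ a k → Unique (continuations a k)
walksFrom-unique a k = Unique.map⁺ (λ { refl → refl }) (continuations-unique a k)
continuations-unique a 0       = All.[] Unique.∷ Unique.[]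
continuations-unique a (suc k) =
  Unique.++⁺ (walksFrom-unique (a - 1ℤ) k)
    (Unique.++⁺ (walksFrom-unique a k) (walksFrom-unique (a +ℤ 1ℤ) k) (walksFrom-disjoint (i≢i+1 a)))
    (Disjoint-++⁺ʳ (walksFrom-disjoint (i-1≢i a)) (walksFrom-disjoint (i-1≢i+1 a)))

length-walksFrom : ∀ a k → length (walksFrom a k) ≡ 3 ^ k
length-continuations : ∀ a k → length (continuations a k) ≡ 3 ^ k
length-walksFrom a k = trans (length-map (a ∷_) (continuations a k)) (length-continuations a k)
length-continuations a 0       = refl
length-continuations a (suc k) = begin
  length (W₋ ++ W₀ ++ W₊)
    ≡⟨ length-++ W₋ ⟩
  length W₋ + length (W₀ ++ W₊)
    ≡⟨ cong (length W₋ +_) (length-++ W₀) ⟩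
  length W₋ + (length W₀ + length W₊)
    ≡⟨ cong₂ _+_ (length-walksFrom _ k) (cong₂ _+_ (length-walksFrom a k) (length-walksFrom _ k)) ⟩
  3 ^ k + (3 ^ k + 3 ^ k)
    ≡⟨ p+[p+p]≡3p (3 ^ k) ⟩
  3 ^ suc k ∎
  where
  open ≡-Reasoning
  W₋ = walksFrom (a - 1ℤ) k
  W₀ = walksFrom a k
  W₊ = walksFrom (a +ℤ 1ℤ) k
  p+[p+p]≡3p : ∀ p → p + (p + p) ≡ 3 * p
  p+[p+p]≡3p = ℕ-Solver.solve-∀

differ : ℤ → ℤ → ℕ
differ a b = if does (a ≟ℤ b) then 0 else 1

differ-refl : ∀ a → differ a a ≡ 0
differ-refl a rewrite dec-true (a ≟ℤ a) refl = refl

differ-≢ : a ≢ b → differ a b ≡ 1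
differ-≢ {a} {b} a≢b rewrite dec-false (a ≟ℤ b) a≢b = refl

changes : ℤ → Vec ℤ k → ℕ
changes a []      = 0
changes a (b ∷ w) = differ a b + changes b w

deduplicate-∷-∷ : {A : Set} (_≟_ : DecidableEquality A) (x : A) (xs : List A) →
  deduplicate _≟_ (x ∷ x ∷ xs) ≡ deduplicate _≟_ (x ∷ xs)
deduplicate-∷-∷ _≟_ x xs =
  cong (x ∷_) (trans (filter-reject x≢? (λ x≢x → x≢x refl)) (filter-idem x≢? (deduplicate _≟_ xs)))
  where x≢? = ¬? ∘ (x ≟_)

length-deduplicate-∷ : {A : Set} (_≟_ : DecidableEquality A) (x : A) (xs : List A) →
  length (deduplicate _≟_ (x ∷ xs)) ≤ suc (length (deduplicate _≟_ xs))
length-deduplicate-∷ _≟_ x xs = s≤s (length-filter (¬? ∘ (x ≟_)) (deduplicate _≟_ xs))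

rng≤1+changes : (a : ℤ) (w : Vec ℤ k) → rng (a ∷ w) ≤ suc (changes a w)
rng≤1+changes a []      = ≤-refl
rng≤1+changes a (b ∷ w) = by-cases (a ≟ℤ b)
  where
  by-cases : Dec (a ≡ b) → rng (a ∷ b ∷ w) ≤ suc (changes a (b ∷ w))
  by-cases (yes refl) rewrite differ-refl a =
    ≤-trans (≤-reflexive (cong length (deduplicate-∷-∷ _≟ℤ_ a (toList w)))) (rng≤1+changes a w)
  by-cases (no a≢b) rewrite differ-≢ a≢b =
    ≤-trans (length-deduplicate-∷ _≟ℤ_ a (b ∷ toList w)) (s≤s (rng≤1+changes b w))

sum-map-c+ : {A : Set} (c : ℕ) (f : A → ℕ) (xs : List A) →
  sum (map (λ x → c + f x) xs) ≡ length xs * c + sum (map f xs)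
sum-map-c+ c f []       = refl
sum-map-c+ c f (x ∷ xs) rewrite sum-map-c+ c f xs = interchange c (f x) (length xs * c) (sum (map f xs))
  where
  interchange : ∀ a b p q → a + b + (p + q) ≡ a + p + (b + q)
  interchange = ℕ-Solver.solve-∀

sum-map-mono : {A : Set} {f g : A → ℕ} → (∀ x → f x ≤ g x) → (xs : List A) →
  sum (map f xs) ≤ sum (map g xs)
sum-map-mono f≤g []       = z≤n
sum-map-mono f≤g (x ∷ xs) = +-mono-≤ (f≤g x) (sum-map-mono f≤g xs)

totalChanges : ℤ → ℕ → ℕ
totalChanges a k = sum (map (changes a) (continuations a k))

sum-changes-walksFrom : ∀ a b k →
  sum (map (changes a) (walksFrom b k)) ≡ 3 ^ k * differ a b + totalChanges b k
sum-changes-walksFrom a b k = begin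
  sum (map (changes a) (map (b ∷_) W))
    ≡⟨ cong sum (map-∘ W) ⟨
  sum (map (λ w → differ a b + changes b w) W)
    ≡⟨ sum-map-c+ (differ a b) (changes b) W ⟩
  length W * differ a b + totalChanges b k
    ≡⟨ cong (λ n → n * differ a b + totalChanges b k) (length-continuations b k) ⟩
  3 ^ k * differ a b + totalChanges b k ∎
  where
  open ≡-Reasoning
  W = continuations b k

totalChanges-suc : ∀ a k → totalChanges a (suc k) ≡
  (3 ^ k * 1 + totalChanges (a - 1ℤ) k) + ((3 ^ k * 0 + totalChanges a k) + (3 ^ k * 1 + totalChanges (a +ℤ 1ℤ) k))
totalChanges-suc a k = begin
  changesIn (W₋ ++ W₀ ++ W₊)
    ≡⟨ changesIn-++ W₋ ⟩
  changesIn W₋ + changesIn (W₀ ++ W₊)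
    ≡⟨ cong (changesIn W₋ +_) (changesIn-++ W₀) ⟩
  changesIn W₋ + (changesIn W₀ + changesIn W₊)
    ≡⟨ cong₂ _+_ (sum-changes-walksFrom a _ k) (cong₂ _+_ (sum-changes-walksFrom a a k) (sum-changes-walksFrom a _ k)) ⟩
  (p * differ a (a - 1ℤ) + T₋) + ((p * differ a a + T₀) + (p * differ a (a +ℤ 1ℤ) + T₊))
    ≡⟨ cong₃ (λ d₋ d₀ d₊ → (p * d₋ + T₋) + ((p * d₀ + T₀) + (p * d₊ + T₊)))
             (differ-≢ (i-1≢i a ∘ sym)) (differ-refl a) (differ-≢ (i≢i+1 a)) ⟩
  (p * 1 + T₋) + ((p * 0 + T₀) + (p * 1 + T₊)) ∎
  where
  open ≡-Reasoning
  changesIn : List (Vec ℤ (suc k)) → ℕ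
  changesIn xs = sum (map (changes a) xs)
  changesIn-++ : ∀ xs {ys} → changesIn (xs ++ ys) ≡ changesIn xs + changesIn ys
  changesIn-++ xs {ys} = trans (cong sum (map-++ (changes a) xs ys)) (sum-++ (map (changes a) xs) _)
  cong₃ : ∀ (f : ℕ → ℕ → ℕ → ℕ) {x x′ y y′ z z′} → x ≡ x′ → y ≡ y′ → z ≡ z′ → f x y z ≡ f x′ y′ z′
  cong₃ f refl refl refl = refl
  p  = 3 ^ k
  W₋ = walksFrom (a - 1ℤ) k
  W₀ = walksFrom a k
  W₊ = walksFrom (a +ℤ 1ℤ) k
  T₋ = totalChanges (a - 1ℤ) k
  T₀ = totalChanges a k
  T₊ = totalChanges (a +ℤ 1ℤ) k

3*totalChanges≡2k3^k : ∀ a k → 3 * totalChanges a k ≡ 2 * k * 3 ^ k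
3*totalChanges≡2k3^k a 0       = refl
3*totalChanges≡2k3^k a (suc k) = begin
  3 * totalChanges a (suc k)
    ≡⟨ cong (3 *_) (totalChanges-suc a k) ⟩
  3 * ((p * 1 + T₋) + ((p * 0 + T₀) + (p * 1 + T₊)))
    ≡⟨ distribute p T₋ T₀ T₊ ⟩
  6 * p + (3 * T₋ + (3 * T₀ + 3 * T₊))
    ≡⟨ cong (6 * p +_) (cong₂ _+_ (ih (a - 1ℤ)) (cong₂ _+_ (ih a) (ih (a +ℤ 1ℤ)))) ⟩
  6 * p + (2 * k * p + (2 * k * p + 2 * k * p))
    ≡⟨ collect k p ⟩
  2 * suc k * 3 ^ suc k ∎
  where
  open ≡-Reasoning
  p  = 3 ^ k
  T₋ = totalChanges (a - 1ℤ) k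
  T₀ = totalChanges a k
  T₊ = totalChanges (a +ℤ 1ℤ) k
  ih : ∀ b → 3 * totalChanges b k ≡ 2 * k * p
  ih b = 3*totalChanges≡2k3^k b k
  distribute : ∀ p x y z → 3 * ((p * 1 + x) + ((p * 0 + y) + (p * 1 + z))) ≡ 6 * p + (3 * x + (3 * y + 3 * z))
  distribute = ℕ-Solver.solve-∀
  collect : ∀ k p → 6 * p + (2 * k * p + (2 * k * p + 2 * k * p)) ≡ 2 * suc k * (3 * p)
  collect = ℕ-Solver.solve-∀

sum-rng-walksFrom : ∀ a k → sum (map rng (walksFrom a k)) ≤ 3 ^ k * 1 + totalChanges a k
sum-rng-walksFrom a k = begin
  sum (map rng (map (a ∷_) W))           ≡⟨ cong sum (map-∘ W) ⟨
  sum (map (rng ∘ (a ∷_)) W)             ≤⟨ sum-map-mono (rng≤1+changes a) W ⟩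
  sum (map (λ w → 1 + changes a w) W)    ≡⟨ sum-map-c+ 1 (changes a) W ⟩
  length W * 1 + totalChanges a k        ≡⟨ cong (λ n → n * 1 + totalChanges a k) (length-continuations a k) ⟩
  3 ^ k * 1 + totalChanges a k           ∎
  where
  open ≤-Reasoning
  W = continuations a k

Lipschitz1⇒∈walksFrom : ∀ {m} (f : Map (suc m)) → Lipschitz1 f → f ∈ walksFrom 0ℤ m
Lipschitz1⇒∈walksFrom (_ ∷ w) (refl , lip) = ∈-map⁺ _ (∈-continuations⁺ (lipschitz⇒walk w lip))

∈walksFrom⇒Lipschitz1 : ∀ {m} (f : Map (suc m)) → f ∈ walksFrom 0ℤ m → Lipschitz1 f
∈walksFrom⇒Lipschitz1 f f∈ with ∈-map⁻ _ f∈
... | _ , w∈ , refl = refl , walk⇒lipschitz (∈-continuations⁻ w∈)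

enumeration↭walksFrom : ∀ {m} {L : List (Map (suc m))} →
  Unique L → All Lipschitz1 L → ((f : Map (suc m)) → Lipschitz1 f → f ∈ L) → L ↭ walksFrom 0ℤ m
enumeration↭walksFrom {m} unique lipschitz complete = ∼bag⇒↭ (unique∧set⇒bag unique (walksFrom-unique 0ℤ m)
  (mk⇔ (Lipschitz1⇒∈walksFrom _ ∘ All.lookup lipschitz) (complete _ ∘ ∈walksFrom⇒Lipschitz1 _)))

corollary3 : (m : ℕ) (L : List (Map (suc m))) →
    Unique L → All Lipschitz1 L → ((f : Map (suc m)) → Lipschitz1 f → f ∈ L) →
    3 * sum (map rng L) ≤ (2 * suc m + 1) * length L
corollary3 m L unique lipschitz complete = begin
  3 * sum (map rng L)                    ≡⟨ cong (3 *_) (sum-↭ (↭-map⁺ rng L↭W)) ⟩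
  3 * sum (map rng (walksFrom 0ℤ m))     ≤⟨ *-monoʳ-≤ 3 (sum-rng-walksFrom 0ℤ m) ⟩
  3 * (3 ^ m * 1 + totalChanges 0ℤ m)    ≡⟨ average (3 ^ m) (3*totalChanges≡2k3^k 0ℤ m) ⟩
  (2 * suc m + 1) * 3 ^ m                ≡⟨ cong ((2 * suc m + 1) *_) 3^m≡length ⟩
  (2 * suc m + 1) * length L             ∎
  where
  open ≤-Reasoning
  L↭W = enumeration↭walksFrom unique lipschitz complete
  3^m≡length : 3 ^ m ≡ length L
  3^m≡length = trans (sym (length-walksFrom 0ℤ m)) (sym (↭-length L↭W))
  average : ∀ p {t} → 3 * t ≡ 2 * m * p → 3 * (p * 1 + t) ≡ (2 * suc m + 1) * p
  average p {t} 3t≡2mp = trans (distribute p t) (trans (cong (3 * p +_) 3t≡2mp) (collect m p))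
    where
    distribute : ∀ p t → 3 * (p * 1 + t) ≡ 3 * p + 3 * t
    distribute = ℕ-Solver.solve-∀
    collect : ∀ m p → 3 * p + 2 * m * p ≡ (2 * suc m + 1) * p
    collect = ℕ-Solver.solve-∀
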